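{- Let $H$ be a hypergraph, $B\subseteq V(H)$ and $B^*\subseteq E(H)$. Then $B$ is a lazy burning set for $H$ and $B^*$ is a lazy burning set for $H^*$ if and only if $B\cup B^*$ is a skew zero forcing set for $\mathrm{IG}(H)$. In particular, $z_0(\mathrm{IG}(H))=b_L(H)+b_L(H^*)$.
   Context: A hypergraph $H$ consists of a finite vertex set $V(H)$ and a finite collection $E(H)$ of subsets of $V(H)$ (repeated hyperedges allowed). Lazy burning: a set $B\subseteq V(H)$ is burned initially; in each subsequent round every unburned vertex $v$ for which some hyperedge $h\ni v$ has $h\setminus\{v\}$ entirely burned becomes burned. $B$ is a lazy burning set if eventually all vertices burn; $b_L(H)$ is the minimum size of one. The dual $H^*$ has vertex set $E(H)$ and hyperedges $N(v)=\{h\in E(H): v\in h\}$ for $v\in V(H)$. The incidence graph $\mathrm{IG}(H)$ is the bipartite graph on $V(H)\cup E(H)$ with $v\sim h$ iff $v\in h$. Skew zero forcing on a graph $G$: an initial set of vertices is black, the rest white; repeatedly, any vertex $u$ (black or white) with exactly one white neighbor $w$ turns $w$ black. A skew zero forcing set is an initial black set from which all vertices eventually become black; $z_0(G)$ is the minimum size of one. -}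

module Defs where

open import Data.Nat using (ℕ; zero; suc; _+_; _≤_)
open import Data.Bool using (Bool; true; false)
open import Data.Fin using (Fin; splitAt)
open import Data.Fin.Subset using (Subset; _∈_; ∣_∣)
open import Data.Sum using (_⊎_; inj₁; inj₂)
open import Data.Product using (Σ; ∃; _×_)
open import Data.Empty using (⊥)
open import Relation.Binary.PropositionalEquality using (_≡_; _≢_)

-- A hypergraph with vertex set Fin nV and hyperedges indexed by Fin nE
-- (so repeated hyperedges are allowed); v ∈ h iff inc v h ≡ true.
record Hypergraph : Set where
  field
    nV  : ℕ
    nE  : ℕ
    inc : Fin nV → Fin nE → Bool
open Hypergraph public

dual : Hypergraph → Hypergraph
dual H = record { nV = nE H ; nE = nV H ; inc = λ h v → inc H v h }

BurnedAt : (H : Hypergraph) → Subset (nV H) → ℕ → Fin (nV H) → Set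
BurnedAt H B zero    v = v ∈ B
BurnedAt H B (suc k) v =
  BurnedAt H B k v ⊎
  Σ (Fin (nE H)) λ h → (inc H v h ≡ true) ×
    ((u : Fin (nV H)) → inc H u h ≡ true → u ≢ v → BurnedAt H B k u)

IsLazyBurningSet : (H : Hypergraph) → Subset (nV H) → Set
IsLazyBurningSet H B = (v : Fin (nV H)) → ∃ λ k → BurnedAt H B k v

record Graph : Set where
  field
    N   : ℕ
    adj : Fin N → Fin N → Bool
open Graph public

-- Skew zero forcing, round by round: BlackAt G S k w = w is black after k rounds.
-- w turns black if some vertex u (of any colour) is adjacent to w and all
-- other neighbours of u are black (so w is u's unique white neighbour).
BlackAt : (G : Graph) → Subset (N G) → ℕ → Fin (N G) → Set
BlackAt G S zero    w = w ∈ S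
BlackAt G S (suc k) w =
  BlackAt G S k w ⊎
  Σ (Fin (N G)) λ u → (adj G u w ≡ true) ×
    ((w' : Fin (N G)) → adj G u w' ≡ true → w' ≢ w → BlackAt G S k w')

IsSkewZeroForcingSet : (G : Graph) → Subset (N G) → Set
IsSkewZeroForcingSet G S = (w : Fin (N G)) → ∃ λ k → BlackAt G S k w

-- Incidence graph: vertex set Fin (nV + nE); the first nV indices are the
-- vertices of H, the last nE are the hyperedges (Data.Fin.splitAt).
IGadj : (H : Hypergraph) → Fin (nV H + nE H) → Fin (nV H + nE H) → Bool
IGadj H x y with splitAt (nV H) x | splitAt (nV H) y
... | inj₁ v | inj₂ h = inc H v h
... | inj₂ h | inj₁ v = inc H v h
... | inj₁ _ | inj₁ _ = false
... | inj₂ _ | inj₂ _ = false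

IG : Hypergraph → Graph
IG H = record { N = nV H + nE H ; adj = IGadj H }

IsMinimum : {n : ℕ} → (Subset n → Set) → ℕ → Set
IsMinimum {n} P k = (Σ (Subset n) λ S → (∣ S ∣ ≡ k) × P S)
                  × ((S : Subset n) → P S → k ≤ ∣ S ∣)

-- In IG(H) a vertex v of H can only be forced by a hyperedge h ∋ v, and h does so
-- exactly when all other vertices of h are black: this is a lazy burning step of H.
-- Symmetrically, a hyperedge h is forced by some v ∈ h once every other hyperedge
-- through v is black: a lazy burning step of H*. So skew forcing from B ∪ B* runs
-- lazy burning of H from B and of H* from B* side by side, round for round, and
-- minimum sizes add up because subsets of V(H) ∪ E(H) split as B ∪ B*.
module Submission where

open import Defs
open import Data.Nat using (ℕ; zero; suc; _+_; _≤_)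
open import Data.Nat.Properties using (+-mono-≤)
open import Data.Bool using (true; false)
open import Data.Fin using (Fin; splitAt; _↑ˡ_; _↑ʳ_)
open import Data.Fin.Properties using (splitAt-↑ˡ; splitAt-↑ʳ; splitAt⁻¹-↑ˡ; splitAt⁻¹-↑ʳ; ↑ˡ-injective; ↑ʳ-injective)
open import Data.Fin.Subset using (Subset; _∈_; ∣_∣)
open import Data.Vec using (_∷_; []; _++_; lookup)
import Data.Vec as Vec
open import Data.Vec.Properties using (lookup-++ˡ; lookup-++ʳ; []=↔lookup)
open import Data.Sum using (inj₁; inj₂)
open import Data.Product using (∃; _×_; _,_; map₂)
open import Function.Bundles using (_⇔_; mk⇔; Equivalence; Inverse)
open import Relation.Binary.PropositionalEquality using (_≡_; _≢_; refl; sym; trans; cong; cong₂; subst)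
open import Relation.Nullary using (contradiction)

data Split (n m : ℕ) : Fin (n + m) → Set where
  left  : (i : Fin n) → Split n m (i ↑ˡ m)
  right : (j : Fin m) → Split n m (n ↑ʳ j)

split : ∀ n {m} (x : Fin (n + m)) → Split n m x
split n {m} x with splitAt n x in eq
... | inj₁ i = subst (Split n m) (splitAt⁻¹-↑ˡ eq) (left i)
... | inj₂ j = subst (Split n m) (splitAt⁻¹-↑ʳ eq) (right j)

∣p++q∣≡∣p∣+∣q∣ : ∀ {n m} (p : Subset n) (q : Subset m) → ∣ p ++ q ∣ ≡ ∣ p ∣ + ∣ q ∣
∣p++q∣≡∣p∣+∣q∣ []          q = refl
∣p++q∣≡∣p∣+∣q∣ (true ∷ p)  q = cong suc (∣p++q∣≡∣p∣+∣q∣ p q)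
∣p++q∣≡∣p∣+∣q∣ (false ∷ p) q = ∣p++q∣≡∣p∣+∣q∣ p q

IsMinimum-++ : ∀ {n m p q} {P : Subset n → Set} {Q : Subset m → Set} {R : Subset (n + m) → Set}
  → (∀ X Y → (P X × Q Y) ⇔ R (X ++ Y))
  → IsMinimum P p → IsMinimum Q q → IsMinimum R (p + q)
IsMinimum-++ {n} {p = p} {q} {R = R} P×Q⇔R ((X , ∣X∣≡p , PX) , p≤) ((Y , ∣Y∣≡q , QY) , q≤) =
  (X ++ Y , trans (∣p++q∣≡∣p∣+∣q∣ X Y) (cong₂ _+_ ∣X∣≡p ∣Y∣≡q) , Equivalence.to (P×Q⇔R X Y) (PX , QY))
  , p+q≤
  where
    p+q≤ : ∀ S → R S → p + q ≤ ∣ S ∣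
    p+q≤ S RS with Vec.splitAt n S
    ... | X′ , Y′ , refl with Equivalence.from (P×Q⇔R X′ Y′) RS
    ... | PX′ , QY′ = subst (p + q ≤_) (sym (∣p++q∣≡∣p∣+∣q∣ X′ Y′)) (+-mono-≤ (p≤ X′ PX′) (q≤ Y′ QY′))

module SkewForcingAsLazyBurning
  (G : Graph) (K : Hypergraph)
  (ι : Fin (nV K) → Fin (N G)) (κ : Fin (nE K) → Fin (N G))
  (ι-injective : ∀ {u v} → ι u ≡ ι v → u ≡ v)
  (adj-κι : ∀ h v → adj G (κ h) (ι v) ≡ inc K v h)
  (adj-into-ι : ∀ {u v} → adj G u (ι v) ≡ true → ∃ λ h → u ≡ κ h)
  (adj-from-κ : ∀ {h w} → adj G (κ h) w ≡ true → ∃ λ v → w ≡ ι v)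
  (S : Subset (N G)) (B : Subset (nV K))
  (lookup-S-ι : ∀ v → lookup S (ι v) ≡ lookup B v)
  where

  ι∈S⇔∈B : ∀ v → ι v ∈ S ⇔ v ∈ B
  ι∈S⇔∈B v = mk⇔
    (λ ιv∈S → Inverse.from []=↔lookup (trans (sym (lookup-S-ι v)) (Inverse.to []=↔lookup ιv∈S)))
    (λ v∈B → Inverse.from []=↔lookup (trans (lookup-S-ι v) (Inverse.to []=↔lookup v∈B)))

  burned⇒black : ∀ k v → BurnedAt K B k v → BlackAt G S k (ι v)
  burned⇒black zero v v∈B = Equivalence.from (ι∈S⇔∈B v) v∈B
  burned⇒black (suc k) v (inj₁ burned) = inj₁ (burned⇒black k v burned)
  burned⇒black (suc k) v (inj₂ (h , v∈h , othersBurned)) =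
    inj₂ (κ h , trans (adj-κι h v) v∈h , othersBlack)
    where
      othersBlack : ∀ w → adj G (κ h) w ≡ true → w ≢ ι v → BlackAt G S k w
      othersBlack w κh∼w w≢ιv with adj-from-κ κh∼w
      ... | u , refl = burned⇒black k u
            (othersBurned u (trans (sym (adj-κι h u)) κh∼w) (λ u≡v → w≢ιv (cong ι u≡v)))

  black⇒burned : ∀ k v → BlackAt G S k (ι v) → BurnedAt K B k v
  black⇒burned zero v ιv∈S = Equivalence.to (ι∈S⇔∈B v) ιv∈S
  black⇒burned (suc k) v (inj₁ black) = inj₁ (black⇒burned k v black)
  black⇒burned (suc k) v (inj₂ (u , u∼ιv , othersBlack)) with adj-into-ι u∼ιv
  ... | h , refl = inj₂ (h , trans (sym (adj-κι h v)) u∼ιv , othersBurned)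
    where
      othersBurned : ∀ u → inc K u h ≡ true → u ≢ v → BurnedAt K B k u
      othersBurned u u∈h u≢v =
        black⇒burned k u (othersBlack (ι u) (trans (adj-κι h u) u∈h) (λ ιu≡ιv → u≢v (ι-injective ιu≡ιv)))

  eventuallyBlack⇔eventuallyBurned : ∀ v → (∃ λ k → BlackAt G S k (ι v)) ⇔ (∃ λ k → BurnedAt K B k v)
  eventuallyBlack⇔eventuallyBurned v = mk⇔ (map₂ (black⇒burned _ v)) (map₂ (burned⇒black _ v))

module IncidenceGraph (H : Hypergraph) where

  private
    n = nV H
    m = nE H

  IGadj-↑ˡ↑ʳ : ∀ v h → IGadj H (v ↑ˡ m) (n ↑ʳ h) ≡ inc H v h
  IGadj-↑ˡ↑ʳ v h rewrite splitAt-↑ˡ n v m | splitAt-↑ʳ n m h = refl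

  IGadj-↑ʳ↑ˡ : ∀ h v → IGadj H (n ↑ʳ h) (v ↑ˡ m) ≡ inc H v h
  IGadj-↑ʳ↑ˡ h v rewrite splitAt-↑ʳ n m h | splitAt-↑ˡ n v m = refl

  IGadj-↑ˡ↑ˡ : ∀ u v → IGadj H (u ↑ˡ m) (v ↑ˡ m) ≡ false
  IGadj-↑ˡ↑ˡ u v rewrite splitAt-↑ˡ n u m | splitAt-↑ˡ n v m = refl

  IGadj-↑ʳ↑ʳ : ∀ g h → IGadj H (n ↑ʳ g) (n ↑ʳ h) ≡ false
  IGadj-↑ʳ↑ʳ g h rewrite splitAt-↑ʳ n m g | splitAt-↑ʳ n m h = refl

  IGadj-into-↑ˡ : ∀ {x v} → IGadj H x (v ↑ˡ m) ≡ true → ∃ λ h → x ≡ n ↑ʳ h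
  IGadj-into-↑ˡ {x} {v} x∼v with split n x
  ... | left u  = contradiction (trans (sym (IGadj-↑ˡ↑ˡ u v)) x∼v) λ ()
  ... | right h = h , refl

  IGadj-into-↑ʳ : ∀ {x h} → IGadj H x (n ↑ʳ h) ≡ true → ∃ λ v → x ≡ v ↑ˡ m
  IGadj-into-↑ʳ {x} {h} x∼h with split n x
  ... | left v  = v , refl
  ... | right g = contradiction (trans (sym (IGadj-↑ʳ↑ʳ g h)) x∼h) λ ()

  IGadj-from-↑ʳ : ∀ {h x} → IGadj H (n ↑ʳ h) x ≡ true → ∃ λ v → x ≡ v ↑ˡ m
  IGadj-from-↑ʳ {h} {x} h∼x with split n x
  ... | left v  = v , refl
  ... | right g = contradiction (trans (sym (IGadj-↑ʳ↑ʳ h g)) h∼x) λ ()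

  IGadj-from-↑ˡ : ∀ {v x} → IGadj H (v ↑ˡ m) x ≡ true → ∃ λ h → x ≡ n ↑ʳ h
  IGadj-from-↑ˡ {v} {x} v∼x with split n x
  ... | left u  = contradiction (trans (sym (IGadj-↑ˡ↑ˡ v u)) v∼x) λ ()
  ... | right h = h , refl

  module _ (B : Subset n) (B* : Subset m) where

    module Vertices = SkewForcingAsLazyBurning (IG H) H (_↑ˡ m) (n ↑ʳ_)
      (↑ˡ-injective m _ _) IGadj-↑ʳ↑ˡ IGadj-into-↑ˡ IGadj-from-↑ʳ
      (B ++ B*) B (lookup-++ˡ B B*)

    module Edges = SkewForcingAsLazyBurning (IG H) (dual H) (n ↑ʳ_) (_↑ˡ m)
      (↑ʳ-injective n _ _) IGadj-↑ˡ↑ʳ IGadj-into-↑ʳ IGadj-from-↑ˡ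
      (B ++ B*) B* (lookup-++ʳ B B*)

    lazyBurning×lazyBurning⇔skewZeroForcing :
      (IsLazyBurningSet H B × IsLazyBurningSet (dual H) B*) ⇔ IsSkewZeroForcingSet (IG H) (B ++ B*)
    lazyBurning×lazyBurning⇔skewZeroForcing = mk⇔ forces burns
      where
        forces : IsLazyBurningSet H B × IsLazyBurningSet (dual H) B* → IsSkewZeroForcingSet (IG H) (B ++ B*)
        forces (burnsH , burnsH*) x with split n x
        ... | left v  = Equivalence.from (Vertices.eventuallyBlack⇔eventuallyBurned v) (burnsH v)
        ... | right h = Equivalence.from (Edges.eventuallyBlack⇔eventuallyBurned h) (burnsH* h)

        burns : IsSkewZeroForcingSet (IG H) (B ++ B*) → IsLazyBurningSet H B × IsLazyBurningSet (dual H) B*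
        burns black = (λ v → Equivalence.to (Vertices.eventuallyBlack⇔eventuallyBurned v) (black (v ↑ˡ m)))
                    , (λ h → Equivalence.to (Edges.eventuallyBlack⇔eventuallyBurned h) (black (n ↑ʳ h)))

open IncidenceGraph using (lazyBurning×lazyBurning⇔skewZeroForcing)

theorem4p9 : (H : Hypergraph)
    → ((B : Subset (nV H)) (B* : Subset (nE H))
         → (IsLazyBurningSet H B × IsLazyBurningSet (dual H) B*)
           ⇔ IsSkewZeroForcingSet (IG H) (B ++ B*))
    × ((bL bL* : ℕ)
         → IsMinimum (IsLazyBurningSet H) bL
         → IsMinimum (IsLazyBurningSet (dual H)) bL*
         → IsMinimum (IsSkewZeroForcingSet (IG H)) (bL + bL*))
theorem4p9 H = lazyBurning×lazyBurning⇔skewZeroForcing H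
             , λ _ _ → IsMinimum-++ (lazyBurning×lazyBurning⇔skewZeroForcing H)
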